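{- Let $p$ be an odd prime and $k\in\mathbb{N}$ with $k\ge2$. A $t$-nomial in $(\mathbb{Z}/p^k\mathbb{Z})[x]$ of degree strictly less than $\varphi(p^k)$ that reduces well modulo $p$ is uniquely determined (among such polynomials) by its values at the points of $\{1,\dots,p-1,p+1,\dots,2p-1\}$.
   Context: A $t$-nomial is a polynomial with at most $t$ non-zero terms. A polynomial $f=\sum_j a_jx^{\alpha_j}\in(\mathbb{Z}/p^k\mathbb{Z})[x]$, written with distinct exponents and all $a_j\ne0$, reduces well modulo $p$ if $p\nmid a_j$ for every $j$ and $p-1\nmid\alpha_j-\alpha_\ell$ for every $j\ne\ell$. $\varphi$ is Euler's totient function. -}

module Defs where

open import Data.Nat using (ℕ; zero; suc; _+_; _*_; _∸_; _^_; _≤_; _<_; _≟_)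
open import Data.Product using (_×_)
open import Data.Nat.Coprimality using (coprime?)
open import Data.Nat.Divisibility using (_∣_)
open import Data.Fin using (Fin; toℕ) renaming (zero to fzero; suc to fsuc)
open import Data.List using (List; length; filter; map; upTo)
open import Data.Integer as ℤ using (ℤ; +_)
import Data.Integer.Divisibility as ℤD
open import Relation.Nullary using (¬_)
open import Relation.Binary.PropositionalEquality using (_≡_)
open import Relation.Nullary.Decidable using (⌊_⌋)
open import Data.Bool using (if_then_else_)

totient : ℕ → ℕ
totient n = length (filter (λ m → coprime? m n) (map suc (upTo n)))

-- A polynomial over ℤ/mℤ of degree < N, given by its coefficient vector:
-- coefficient of x^i is the residue (c i) ∈ Fin m ≅ ℤ/mℤ.
Poly : ℕ → ℕ → Set
Poly m N = Fin N → Fin m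

ΣFin : (N : ℕ) → (Fin N → ℕ) → ℕ
ΣFin zero    f = 0
ΣFin (suc N) f = f fzero + ΣFin N (λ i → f (fsuc i))

evalℕ : ∀ {m N} → Poly m N → ℕ → ℕ
evalℕ {N = N} f a = ΣFin N (λ i → toℕ (f i) * a ^ toℕ i)

_≡_[mod_] : ℕ → ℕ → ℕ → Set
x ≡ y [mod m ] = (+ m) ℤD.∣ ((+ x) ℤ.- (+ y))

SameValueAt : ∀ {m N} → Poly m N → Poly m N → ℕ → Set
SameValueAt {m} f g a = evalℕ f a ≡ evalℕ g a [mod m ]

NonzeroCoeff : ∀ {m N} → Poly m N → Fin N → Set
NonzeroCoeff f i = ¬ (toℕ (f i) ≡ 0)

numTerms : ∀ {m N} → Poly m N → ℕ
numTerms {N = N} f = ΣFin N (λ i → if ⌊ toℕ (f i) ≟ 0 ⌋ then 0 else 1)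

IsTNomial : ∀ {m N} → ℕ → Poly m N → Set
IsTNomial t f = numTerms f ≤ t

-- f reduces well modulo p: p ∤ a_j for every non-zero coefficient a_j, and
-- p - 1 ∤ α_j - α_ℓ for distinct exponents α_j ≠ α_ℓ in the support
-- (stated for α_j < α_ℓ, which covers all unordered pairs).
ReducesWell : ∀ {m N} → ℕ → Poly m N → Set
ReducesWell {N = N} p f =
  (∀ (i : Fin N) → NonzeroCoeff f i → ¬ (p ∣ toℕ (f i))) ×
  (∀ (i j : Fin N) → NonzeroCoeff f i → NonzeroCoeff f j →
     toℕ i < toℕ j → ¬ ((p ∸ 1) ∣ (toℕ j ∸ toℕ i)))

InSampleSet : ℕ → ℕ → Set
InSampleSet p a = (1 ≤ a) × (a ≤ 2 * p ∸ 1) × ¬ (a ≡ p)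

-- Group the terms of a polynomial by the class of their exponent modulo p − 1: reducing well
-- means that every class holds at most one term, whose coefficient is a unit. By Fermat, at
-- the points 1, …, p − 1 such a polynomial agrees modulo p with Σₛ cₛ xˢ, of degree < p − 1,
-- so agreement at these points gives equal classes and coefficients modulo p. One then lifts:
-- if the exponents of corresponding terms agree modulo (p − 1)pˡ and the coefficients modulo
-- pˡ⁺¹, write x^((p − 1)pˡ) = 1 + pˡ⁺¹ μₓ; modulo pˡ⁺² the difference f(x) − g(x) becomes
-- pˡ⁺¹ (E(x) + μₓ D(x)), where E and D have degree < p − 1 and record the next p-adic digit of
-- the coefficient and of the exponent differences. For odd p, μ at t and at t + p differ by a
-- unit while E and D do not change modulo p, so D and then E vanish at 1, …, p − 1, hence have
-- coefficients divisible by p. After k − 1 steps the exponents agree modulo φ(pᵏ), which bounds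
-- them, and the coefficients modulo pᵏ.

module Submission where

-- The development is a module of its own so that the integer _^_ it uses does not clash with
-- the natural-number _^_ of the statement at the end.
module Proof where

  open import Data.Nat as ℕ using (ℕ; zero; suc; z≤n; s≤s)
  import Data.Nat.Properties as ℕ
  import Data.Nat.Divisibility as ℕ
  import Data.Nat.DivMod as ℕ
  open import Data.Nat.Primality using (Prime; euclidsLemma; prime⇒nonTrivial)
  open import Data.Nat.Combinatorics using (_C_; nC1≡n; nCn≡1; nCk≡n!/k![n-k]!; k![n∸k]!∣n!)
  open import Data.Nat.Coprimality using (Coprime; coprime?)
  open import Data.Integer as ℤ using (ℤ; +_; _+_; _*_; _-_; -_; _^_)
  import Data.Integer.Properties as ℤ
  open import Data.Integer.Divisibility.Signed
  open import Data.Integer.Tactic.RingSolver using (solve-∀)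
  open import Data.Fin as Fin using (Fin; toℕ)
  import Data.Fin.Properties as Fin
  open import Data.Vec.Functional using (Vector; init; last; tail)
  open import Data.List as List using (List; []; _∷_; _++_; length; filter; applyUpTo; upTo)
  import Data.List.Properties as List
  open import Data.List.Relation.Unary.All as All using (All; []; _∷_)
  import Data.List.Relation.Unary.All.Properties as All
  open import Data.List.Relation.Unary.AllPairs as AllPairs using (AllPairs; []; _∷_)
  import Data.List.Relation.Unary.AllPairs.Properties as AllPairs
  open import Data.Product using (∃; _×_; _,_; proj₁; proj₂)
  open import Data.Sum as Sum using (_⊎_; inj₁; inj₂; [_,_]′)
  open import Function using (_∘_)
  open import Level using (0ℓ)
  open import Relation.Nullary using (¬_; Dec; yes; no; ¬?; contradiction)
  open import Relation.Nullary.Decidable using (decidable-stable; _×-dec_)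
  open import Relation.Unary using (Pred; Decidable)
  open import Relation.Binary.Bundles using (Setoid)
  open import Relation.Binary.Definitions using (tri<; tri≈; tri>)
  open import Relation.Binary.PropositionalEquality
  import Relation.Binary.Reasoning.Setoid
  open import Algebra.Properties.Semiring.Sum ℤ.+-*-semiring
    using (sum; sum-cong-≗; sum-replicate-zero; sum-remove; sum-init-last; *-distribˡ-sum; ∑-distrib-+; ∑-comm)
  open import Algebra.Properties.CommutativeSemiring.Binomial ℤ.+-*-commutativeSemiring
    using (theorem; binomialTerm)
  import Algebra.Definitions.RawSemiring ℤ.+-*-rawSemiring as Semiring
  open import Defs

  -- Congruences of integers

  ∣0 : ∀ {m} → m ∣ + 0
  ∣0 {m} = divides (+ 0) (sym (ℤ.*-zeroˡ m))

  -- A record rather than a definition, so that x and y can be inferred.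
  infix 4 _≈_[mod_]
  record _≈_[mod_] (x y m : ℤ) : Set where
    constructor ∣⇒≈
    field ≈⇒∣ : m ∣ x - y
  open _≈_[mod_] public

  module _ {m : ℤ} where

    ≈-reflexive : ∀ {x y} → x ≡ y → x ≈ y [mod m ]
    ≈-reflexive {x} refl = ∣⇒≈ (subst (m ∣_) (sym (ℤ.+-inverseʳ x)) ∣0)

    ≈-sym : ∀ {x y} → x ≈ y [mod m ] → y ≈ x [mod m ]
    ≈-sym {x} {y} (∣⇒≈ d) = ∣⇒≈ (subst (m ∣_) (eq x y) (∣m⇒∣-m d))
      where eq : ∀ x y → - (x - y) ≡ y - x
            eq = solve-∀

    ≈-trans : ∀ {x y z} → x ≈ y [mod m ] → y ≈ z [mod m ] → x ≈ z [mod m ]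
    ≈-trans {x} {y} {z} (∣⇒≈ d) (∣⇒≈ e) = ∣⇒≈ (subst (m ∣_) (eq x y z) (∣m∣n⇒∣m+n d e))
      where eq : ∀ x y z → (x - y) + (y - z) ≡ x - z
            eq = solve-∀

    ≈-setoid : Setoid 0ℓ 0ℓ
    ≈-setoid = record
      { Carrier       = ℤ
      ; _≈_           = _≈_[mod m ]
      ; isEquivalence = record { refl = ≈-reflexive refl ; sym = ≈-sym ; trans = ≈-trans }
      }

    module ≈-Reasoning = Relation.Binary.Reasoning.Setoid ≈-setoid

    ≈0⇒∣ : ∀ {x} → x ≈ + 0 [mod m ] → m ∣ x
    ≈0⇒∣ {x} (∣⇒≈ d) = subst (m ∣_) (ℤ.+-identityʳ x) d

    ∣⇒≈0 : ∀ {x} → m ∣ x → x ≈ + 0 [mod m ]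
    ∣⇒≈0 {x} d = ∣⇒≈ (subst (m ∣_) (sym (ℤ.+-identityʳ x)) d)

    ≡+*⇒≈ : ∀ {x y} k → x ≡ y + m * k → x ≈ y [mod m ]
    ≡+*⇒≈ {y = y} k refl = ∣⇒≈ (divides k (eq y m k))
      where eq : ∀ y m k → y + m * k - y ≡ k * m
            eq = solve-∀

    ≈⇒≡+* : ∀ {x y} (x≈y : x ≈ y [mod m ]) → x ≡ y + m * quotient (≈⇒∣ x≈y)
    ≈⇒≡+* {x} {y} (∣⇒≈ (divides k x-y≡km)) = begin
      x                ≡⟨ eq x y ⟩
      y + (x - y)      ≡⟨ cong (_+_ y) (trans x-y≡km (ℤ.*-comm k m)) ⟩
      y + m * k        ∎
      where
      open ≡-Reasoning
      eq : ∀ x y → x ≡ y + (x - y)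
      eq = solve-∀

    +-cong-mod : ∀ {x y u v} → x ≈ y [mod m ] → u ≈ v [mod m ] → x + u ≈ y + v [mod m ]
    +-cong-mod {x} {y} {u} {v} (∣⇒≈ d) (∣⇒≈ e) = ∣⇒≈ (subst (m ∣_) (eq x y u v) (∣m∣n⇒∣m+n d e))
      where eq : ∀ x y u v → (x - y) + (u - v) ≡ x + u - (y + v)
            eq = solve-∀

    minus-cong-mod : ∀ {x y u v} → x ≈ y [mod m ] → u ≈ v [mod m ] → x - u ≈ y - v [mod m ]
    minus-cong-mod {x} {y} {u} {v} (∣⇒≈ d) (∣⇒≈ e) = ∣⇒≈ (subst (m ∣_) (eq x y u v) (∣m∣n⇒∣m-n d e))
      where eq : ∀ x y u v → (x - y) - (u - v) ≡ x - u - (y - v)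
            eq = solve-∀

    *-cong-mod : ∀ {x y u v} → x ≈ y [mod m ] → u ≈ v [mod m ] → x * u ≈ y * v [mod m ]
    *-cong-mod {x} {y} {u} {v} (∣⇒≈ d) (∣⇒≈ e) =
      ∣⇒≈ (subst (m ∣_) (eq x y u v) (∣m∣n⇒∣m+n (∣m⇒∣m*n u d) (∣n⇒∣m*n y e)))
      where eq : ∀ x y u v → (x - y) * u + y * (u - v) ≡ x * u - y * v
            eq = solve-∀

    *-congˡ-mod : ∀ x {y z} → y ≈ z [mod m ] → x * y ≈ x * z [mod m ]
    *-congˡ-mod x = *-cong-mod (≈-reflexive {x} refl)

    ^-cong-mod : ∀ {x y} n → x ≈ y [mod m ] → x ^ n ≈ y ^ n [mod m ]
    ^-cong-mod zero    x≈y = ≈-reflexive refl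
    ^-cong-mod (suc n) x≈y = *-cong-mod x≈y (^-cong-mod n x≈y)

    sum-cong-mod : ∀ {n} {f g : Vector ℤ n} → (∀ i → f i ≈ g i [mod m ]) → sum f ≈ sum g [mod m ]
    sum-cong-mod {zero}  f≈g = ≈-reflexive refl
    sum-cong-mod {suc n} f≈g = +-cong-mod (f≈g Fin.zero) (sum-cong-mod (f≈g ∘ Fin.suc))

  ≈-weaken : ∀ {k m x y} → k ∣ m → x ≈ y [mod m ] → x ≈ y [mod k ]
  ≈-weaken k∣m (∣⇒≈ d) = ∣⇒≈ (∣-trans k∣m d)

  *-cancelˡ-≈ : ∀ k {m x y} .{{_ : ℤ.NonZero k}} → k * x ≈ k * y [mod m * k ] → x ≈ y [mod m ]
  *-cancelˡ-≈ k {m} {x} {y} (∣⇒≈ d) = ∣⇒≈ (*-cancelˡ-∣ k (subst₂ _∣_ (ℤ.*-comm m k) (eq k x y) d))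
    where eq : ∀ k x y → k * x - k * y ≡ k * (x - y)
          eq = solve-∀

  ≈⇒∣∸ : ∀ {m i j} → i ℕ.≤ j → + i ≈ + j [mod + m ] → m ℕ.∣ j ℕ.∸ i
  ≈⇒∣∸ {m} {i} {j} i≤j (∣⇒≈ d) =
    subst (m ℕ.∣_) (trans (cong ℤ.∣_∣ (ℤ.m-n≡m⊖n i j)) (ℤ.∣⊖∣-≤ i≤j)) (∣⇒∣ᵤ d)

  ∣∧<⇒≡0 : ∀ {m n} → m ℕ.∣ n → n ℕ.< m → n ≡ 0
  ∣∧<⇒≡0 {n = zero}  _   _   = refl
  ∣∧<⇒≡0 {n = suc n} m∣n n<m = contradiction m∣n (ℕ.>⇒∤ n<m)

  ≤∧≈⇒≡ : ∀ {m i j} → i ℕ.≤ j → j ℕ.< m → + i ≈ + j [mod + m ] → i ≡ j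
  ≤∧≈⇒≡ {m} {i} {j} i≤j j<m i≈j =
    ℕ.≤-antisym i≤j (ℕ.m∸n≡0⇒m≤n (∣∧<⇒≡0 (≈⇒∣∸ i≤j i≈j) (ℕ.≤-<-trans (ℕ.m∸n≤m j i) j<m)))

  ≈∧<⇒≡ : ∀ {m i j} → i ℕ.< m → j ℕ.< m → + i ≈ + j [mod + m ] → i ≡ j
  ≈∧<⇒≡ {i = i} {j} i<m j<m i≈j with ℕ.≤-total i j
  ... | inj₁ i≤j = ≤∧≈⇒≡ i≤j j<m i≈j
  ... | inj₂ j≤i = sym (≤∧≈⇒≡ j≤i i<m (≈-sym i≈j))

  pos-^ : ∀ m n → + (m ℕ.^ n) ≡ (+ m) ^ n
  pos-^ m zero    = refl
  pos-^ m (suc n) = trans (ℤ.pos-* m (m ℕ.^ n)) (cong (+ m *_) (pos-^ m n))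

  pos-+* : ∀ a b c → + (a ℕ.+ b ℕ.* c) ≡ + a + + b * + c
  pos-+* a b c = trans (ℤ.pos-+ a (b ℕ.* c)) (cong (_+_ (+ a)) (ℤ.pos-* b c))

  ≈% : ∀ m q .{{_ : ℕ.NonZero q}} → + m ≈ + (m ℕ.% q) [mod + q ]
  ≈% m q = ≡+*⇒≈ (+ (m ℕ./ q)) (begin
    + m                                ≡⟨ cong +_ (ℕ.m≡m%n+[m/n]*n m q) ⟩
    + (m ℕ.% q ℕ.+ m ℕ./ q ℕ.* q)      ≡⟨ cong (λ k → + (m ℕ.% q ℕ.+ k)) (ℕ.*-comm (m ℕ./ q) q) ⟩
    + (m ℕ.% q ℕ.+ q ℕ.* (m ℕ./ q))    ≡⟨ pos-+* (m ℕ.% q) q (m ℕ./ q) ⟩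
    + (m ℕ.% q) + + q * + (m ℕ./ q)    ∎)
    where open ≡-Reasoning

  record CommonBase (m i j : ℕ) : Set where
    field
      base d₁ d₂ : ℕ
      i≡ : i ≡ base ℕ.+ m ℕ.* d₁
      j≡ : j ≡ base ℕ.+ m ℕ.* d₂

  ≤∧∣∸⇒≡+* : ∀ {m i j} → i ℕ.≤ j → (d : m ℕ.∣ j ℕ.∸ i) →
             j ≡ i ℕ.+ m ℕ.* ℕ._∣_.quotient d
  ≤∧∣∸⇒≡+* {m} {i} {j} i≤j d =
    trans (sym (ℕ.m+[n∸m]≡n i≤j)) (cong (i ℕ.+_) (ℕ.m∣n⇒n≡m*quotient d))

  ≡+*0 : ∀ m n → n ≡ n ℕ.+ m ℕ.* 0
  ≡+*0 m n = sym (trans (cong (n ℕ.+_) (ℕ.*-zeroʳ m)) (ℕ.+-identityʳ n))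

  commonBase : ∀ {m i j} → + i ≈ + j [mod + m ] → CommonBase m i j
  commonBase {m} {i} {j} i≈j with ℕ.≤-total i j
  ... | inj₁ i≤j = record
    { base = i ; d₁ = 0 ; d₂ = _ ; i≡ = ≡+*0 m i ; j≡ = ≤∧∣∸⇒≡+* i≤j (≈⇒∣∸ i≤j i≈j) }
  ... | inj₂ j≤i = record
    { base = j ; d₁ = _ ; d₂ = 0 ; i≡ = ≤∧∣∸⇒≡+* j≤i (≈⇒∣∸ j≤i (≈-sym i≈j))
    ; j≡ = ≡+*0 m j }

  commonBase-≈ : ∀ {m i j k} (cb : CommonBase m i j) → let open CommonBase cb in
                 + k ∣ + d₁ - + d₂ → + i ≈ + j [mod + (m ℕ.* k) ]
  commonBase-≈ {m} {i} {j} {k} cb (divides δ d₁-d₂≡δk) = ≡+*⇒≈ δ (begin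
    + i                                           ≡⟨ cong +_ i≡ ⟩
    + (base ℕ.+ m ℕ.* d₁)                         ≡⟨ pos-+* base m d₁ ⟩
    + base + + m * + d₁                           ≡⟨ eq (+ base) (+ m) (+ d₁) (+ d₂) ⟩
    (+ base + + m * + d₂) + + m * (+ d₁ - + d₂)
      ≡⟨ cong₂ (λ u v → u + + m * v) (sym (pos-+* base m d₂)) d₁-d₂≡δk ⟩
    + (base ℕ.+ m ℕ.* d₂) + + m * (δ * + k)       ≡⟨ cong₂ _+_ (cong +_ (sym j≡)) (eq₂ (+ m) δ (+ k)) ⟩
    + j + + m * + k * δ                           ≡⟨ cong (λ u → + j + u * δ) (sym (ℤ.pos-* m k)) ⟩
    + j + + (m ℕ.* k) * δ                         ∎)
    where
    open CommonBase cb
    open ≡-Reasoning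
    eq : ∀ r m d₁ d₂ → r + m * d₁ ≡ r + m * d₂ + m * (d₁ - d₂)
    eq = solve-∀
    eq₂ : ∀ m δ k → m * (δ * k) ≡ m * k * δ
    eq₂ = solve-∀

  ^-reduce : ∀ {k x} m → x ^ m ≈ + 1 [mod k ] → ∀ r d → x ^ (r ℕ.+ m ℕ.* d) ≈ x ^ r [mod k ]
  ^-reduce {k} {x} m xᵐ≈1 r d = begin
    x ^ (r ℕ.+ m ℕ.* d)     ≡⟨ ℤ.^-distribˡ-+-* x r (m ℕ.* d) ⟩
    x ^ r * x ^ (m ℕ.* d)   ≡⟨ cong (x ^ r *_) (sym (ℤ.^-*-assoc x m d)) ⟩
    x ^ r * (x ^ m) ^ d     ≈⟨ *-congˡ-mod (x ^ r) (^-cong-mod d xᵐ≈1) ⟩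
    x ^ r * (+ 1) ^ d       ≡⟨ trans (cong (x ^ r *_) (ℤ.^-zeroˡ d)) (ℤ.*-identityʳ (x ^ r)) ⟩
    x ^ r                   ∎
    where open ≈-Reasoning

  ^-period : ∀ {k x m i j} → x ^ m ≈ + 1 [mod k ] → + i ≈ + j [mod + m ] → x ^ i ≈ x ^ j [mod k ]
  ^-period {k} {x} {m} {i} {j} xᵐ≈1 i≈j = begin
    x ^ i                     ≡⟨ cong (x ^_) i≡ ⟩
    x ^ (base ℕ.+ m ℕ.* d₁)   ≈⟨ ^-reduce m xᵐ≈1 base d₁ ⟩
    x ^ base                  ≈⟨ ^-reduce m xᵐ≈1 base d₂ ⟨
    x ^ (base ℕ.+ m ℕ.* d₂)   ≡⟨ cong (x ^_) j≡ ⟨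
    x ^ j                     ∎
    where
    open CommonBase (commonBase i≈j)
    open ≈-Reasoning

  ^-linear : ∀ u d → (+ 1 + u) ^ d ≈ + 1 + + d * u [mod u * u ]
  ^-linear u zero    = ≈-reflexive (eq u)
    where eq : ∀ u → + 1 ≡ + 1 + + 0 * u
          eq = solve-∀
  ^-linear u (suc d) = begin
    (+ 1 + u) * (+ 1 + u) ^ d     ≈⟨ *-congˡ-mod (+ 1 + u) (^-linear u d) ⟩
    (+ 1 + u) * (+ 1 + + d * u)   ≈⟨ ≡+*⇒≈ (+ d) (eq u (+ d)) ⟩
    + 1 + + suc d * u             ∎
    where
    open ≈-Reasoning
    eq : ∀ u d → (+ 1 + u) * (+ 1 + d * u) ≡ + 1 + (+ 1 + d) * u + u * u * d
    eq = solve-∀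

  term-lift : ∀ A {x} M μ → x ^ M ≡ + 1 + A * μ → ∀ {a} b ε → a ≡ b + A * ε → ∀ r d₁ d₂ →
              a * x ^ (r ℕ.+ M ℕ.* d₁) - b * x ^ (r ℕ.+ M ℕ.* d₂)
                ≈ A * (x ^ r * (ε + μ * b * (+ d₁ - + d₂))) [mod A * A ]
  term-lift A {x} M μ xᴹ≡1+Aμ {a} b ε a≡b+Aε r d₁ d₂ = begin
    a * x ^ (r ℕ.+ M ℕ.* d₁) - b * x ^ (r ℕ.+ M ℕ.* d₂)
      ≈⟨ minus-cong-mod (*-congˡ-mod a (power d₁)) (*-congˡ-mod b (power d₂)) ⟩
    a * (x ^ r * (+ 1 + + d₁ * (A * μ))) - b * (x ^ r * (+ 1 + + d₂ * (A * μ)))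
      ≡⟨ cong (λ a → a * (x ^ r * (+ 1 + + d₁ * (A * μ))) - b * (x ^ r * (+ 1 + + d₂ * (A * μ)))) a≡b+Aε ⟩
    (b + A * ε) * (x ^ r * (+ 1 + + d₁ * (A * μ))) - b * (x ^ r * (+ 1 + + d₂ * (A * μ)))
      ≈⟨ ≡+*⇒≈ (x ^ r * ε * μ * + d₁) (eq A b ε μ (x ^ r) (+ d₁) (+ d₂)) ⟩
    A * (x ^ r * (ε + μ * b * (+ d₁ - + d₂))) ∎
    where
    open ≈-Reasoning
    eq : ∀ A b ε μ X d₁ d₂ →
      (b + A * ε) * (X * (+ 1 + d₁ * (A * μ))) - b * (X * (+ 1 + d₂ * (A * μ)))
        ≡ A * (X * (ε + μ * b * (d₁ - d₂))) + A * A * (X * ε * μ * d₁)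
    eq = solve-∀
    A*A∣[Aμ]² : A * A ∣ A * μ * (A * μ)
    A*A∣[Aμ]² = divides (μ * μ) (eq₂ A μ)
      where eq₂ : ∀ A μ → A * μ * (A * μ) ≡ μ * μ * (A * A)
            eq₂ = solve-∀
    power : ∀ d → x ^ (r ℕ.+ M ℕ.* d) ≈ x ^ r * (+ 1 + + d * (A * μ)) [mod A * A ]
    power d = begin
      x ^ (r ℕ.+ M ℕ.* d)         ≡⟨ ℤ.^-distribˡ-+-* x r (M ℕ.* d) ⟩
      x ^ r * x ^ (M ℕ.* d)       ≡⟨ cong (x ^ r *_) (sym (ℤ.^-*-assoc x M d)) ⟩
      x ^ r * (x ^ M) ^ d         ≡⟨ cong (λ y → x ^ r * y ^ d) xᴹ≡1+Aμ ⟩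
      x ^ r * (+ 1 + A * μ) ^ d   ≈⟨ *-congˡ-mod (x ^ r) (≈-weaken A*A∣[Aμ]² (^-linear (A * μ) d)) ⟩
      x ^ r * (+ 1 + + d * (A * μ)) ∎

  sum-zero : ∀ {n} (f : Vector ℤ n) → (∀ i → f i ≡ + 0) → sum f ≡ + 0
  sum-zero {n} f f≗0 = trans (sum-cong-≗ f≗0) (sum-replicate-zero n)

  sum-single : ∀ {n} (f : Vector ℤ n) i → (∀ j → j ≢ i → f j ≡ + 0) → sum f ≡ f i
  sum-single {suc n} f i f≗0 = begin
    sum f                                   ≡⟨ sum-remove f ⟩
    f i + sum (λ j → f (Fin.punchIn i j))
      ≡⟨ cong (_+_ (f i)) (sum-zero _ λ j → f≗0 _ (Fin.punchInᵢ≢i i j)) ⟩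
    f i + + 0                               ≡⟨ ℤ.+-identityʳ (f i) ⟩
    f i                                     ∎
    where open ≡-Reasoning

  sum-distrib-- : ∀ {n} (f g : Vector ℤ n) → sum (λ i → f i - g i) ≡ sum f - sum g
  sum-distrib-- {zero}  f g = refl
  sum-distrib-- {suc n} f g =
    trans (cong (_+_ (f Fin.zero - g Fin.zero)) (sum-distrib-- (f ∘ Fin.suc) (g ∘ Fin.suc)))
          (eq (f Fin.zero) (g Fin.zero) (sum (f ∘ Fin.suc)) (sum (g ∘ Fin.suc)))
    where eq : ∀ a b c d → a - b + (c - d) ≡ a + c - (b + d)
          eq = solve-∀

  ΣFin≡sum : ∀ N (h : Fin N → ℕ) → + ΣFin N h ≡ sum (λ i → + h i)
  ΣFin≡sum zero    h = refl
  ΣFin≡sum (suc N) h = trans (ℤ.pos-+ (h Fin.zero) _) (cong (_+_ (+ h Fin.zero)) (ΣFin≡sum N (h ∘ Fin.suc)))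

  -- Binomial coefficients and Fermat's little theorem

  prime∤! : ∀ {p m} → Prime p → m ℕ.< p → ¬ p ℕ.∣ m ℕ.!
  prime∤! {p} {zero}  p-prime _ p∣1 =
    ℕ.>⇒≢ (ℕ.nonTrivial⇒n>1 p {{prime⇒nonTrivial p-prime}}) (ℕ.∣1⇒≡1 p∣1)
  prime∤! {p} {suc m} p-prime m<p p∣m! with euclidsLemma (suc m) (m ℕ.!) p-prime p∣m!
  ... | inj₁ p∣1+m = ℕ.<⇒≱ m<p (ℕ.∣⇒≤ p∣1+m)
  ... | inj₂ p∣m!′ = prime∤! p-prime (ℕ.<-trans (ℕ.n<1+n m) m<p) p∣m!′

  nCk*k!*[n-k]!≡n! : ∀ {n k} → k ℕ.≤ n → (n C k) ℕ.* (k ℕ.! ℕ.* (n ℕ.∸ k) ℕ.!) ≡ n ℕ.!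
  nCk*k!*[n-k]!≡n! {n} {k} k≤n =
    trans (cong (ℕ._* (k ℕ.! ℕ.* (n ℕ.∸ k) ℕ.!)) (nCk≡n!/k![n-k]! k≤n))
          (ℕ.m/n*n≡m {{ℕ._!*_!≢0 k (n ℕ.∸ k)}} (k![n∸k]!∣n! k≤n))

  prime∣pCk : ∀ {p k} → Prime p → 0 ℕ.< k → k ℕ.< p → p ℕ.∣ p C k
  prime∣pCk {suc q} {k} p-prime 0<k k<p
    with euclidsLemma (suc q C k) (k ℕ.! ℕ.* (suc q ℕ.∸ k) ℕ.!) p-prime
           (ℕ.divides (q ℕ.!) (trans (nCk*k!*[n-k]!≡n! (ℕ.<⇒≤ k<p)) (ℕ.*-comm (suc q) (q ℕ.!))))
  ... | inj₁ p∣C = p∣C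
  ... | inj₂ p∣k!*[p-k]! with euclidsLemma (k ℕ.!) ((suc q ℕ.∸ k) ℕ.!) p-prime p∣k!*[p-k]!
  ...   | inj₁ p∣k!     = contradiction p∣k! (prime∤! p-prime k<p)
  ...   | inj₂ p∣[p-k]! = contradiction p∣[p-k]! (prime∤! p-prime (ℕ.∸-monoʳ-< 0<k (ℕ.<⇒≤ k<p)))

  -- The binomial theorem of the library is stated with the semiring's own _^_ and _×_.
  ^ₛ≡^ : ∀ x n → x Semiring.^ n ≡ x ^ n
  ^ₛ≡^ x zero    = refl
  ^ₛ≡^ x (suc n) = cong (x *_) (^ₛ≡^ x n)

  ×≡* : ∀ n x → n Semiring.× x ≡ + n * x
  ×≡* zero    x = sym (ℤ.*-zeroˡ x)
  ×≡* (suc n) x = trans (cong (_+_ x) (×≡* n x)) (sym (ℤ.suc-* (+ n) x))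

  ×-term : ∀ c a k b l → c Semiring.× (a Semiring.^ k * b Semiring.^ l) ≡ + c * a ^ k * b ^ l
  ×-term c a k b l = trans (×≡* c _)
    (trans (cong₂ (λ u v → + c * (u * v)) (^ₛ≡^ a k) (^ₛ≡^ b l)) (sym (ℤ.*-assoc (+ c) (a ^ k) (b ^ l))))

  binomialTerm-first : ∀ x y n → binomialTerm x y n Fin.zero ≡ y ^ n
  binomialTerm-first x y n = trans (×-term 1 x 0 y n) (eq (y ^ n))
    where eq : ∀ a → + 1 * + 1 * a ≡ a
          eq = solve-∀

  binomialTerm-last : ∀ x y n → binomialTerm x y n (Fin.fromℕ n) ≡ x ^ n
  binomialTerm-last x y n rewrite Fin.toℕ-fromℕ n | nCn≡1 n | ℕ.n∸n≡0 n =
    trans (×-term 1 x n y 0) (eq (x ^ n))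
    where eq : ∀ a → + 1 * a * + 1 ≡ a
          eq = solve-∀

  freshmans-dream : ∀ {p} → Prime p → ∀ x y → (x + y) ^ p ≈ x ^ p + y ^ p [mod + p ]
  freshmans-dream {suc q} p-prime x y = begin
    (x + y) ^ p                                          ≡⟨ ^ₛ≡^ (x + y) p ⟨
    (x + y) Semiring.^ p                                 ≡⟨ theorem p x y ⟩
    t Fin.zero + sum (tail t)                            ≡⟨ cong (_+_ (t Fin.zero)) (sum-init-last (tail t)) ⟩
    t Fin.zero + (sum (init (tail t)) + last (tail t))
      ≈⟨ +-cong-mod (≈-reflexive (binomialTerm-first x y p))
                    (+-cong-mod middle≈0 (≈-reflexive (binomialTerm-last x y p))) ⟩
    y ^ p + (+ 0 + x ^ p)                                ≡⟨ eq (x ^ p) (y ^ p) ⟩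
    x ^ p + y ^ p                                        ∎
    where
    open ≈-Reasoning
    p = suc q
    t = binomialTerm x y p
    eq : ∀ a b → b + (+ 0 + a) ≡ a + b
    eq = solve-∀
    p∣middle : ∀ i → + p ∣ init (tail t) i
    p∣middle i = subst (+ p ∣_) (sym (×≡* (p C k) _))
                   (∣m⇒∣m*n _ (∣ᵤ⇒∣ {+ p} {+ (p C k)} (prime∣pCk p-prime (s≤s z≤n) k<p)))
      where
      k = suc (toℕ (Fin.inject₁ i))
      k<p : k ℕ.< p
      k<p = s≤s (subst (ℕ._< q) (sym (Fin.toℕ-inject₁ i)) (Fin.toℕ<n i))
    middle≈0 : sum (init (tail t)) ≈ + 0 [mod + p ]
    middle≈0 = ≈-trans (sum-cong-mod (∣⇒≈0 ∘ p∣middle)) (≈-reflexive (sum-replicate-zero q))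

  binomial₂ : ∀ m Y ε → (Y + ε) ^ (2 ℕ.+ m)
    ≈ Y ^ (2 ℕ.+ m) + + (2 ℕ.+ m) * ε * Y ^ (1 ℕ.+ m) + + ((2 ℕ.+ m) C 2) * (ε * ε) * Y ^ m [mod ε * ε * ε ]
  binomial₂ m Y ε = begin
    (Y + ε) ^ n                                ≡⟨ cong (_^ n) (ℤ.+-comm Y ε) ⟩
    (ε + Y) ^ n                                ≡⟨ ^ₛ≡^ (ε + Y) n ⟨
    (ε + Y) Semiring.^ n                       ≡⟨ theorem n ε Y ⟩
    t₀ + (t₁ + (t₂ + sum rest))
      ≈⟨ +-cong-mod (≈-reflexive (binomialTerm-first ε Y n))
                    (+-cong-mod (≈-reflexive second) (+-cong-mod (≈-reflexive third) rest≈0)) ⟩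
    Y ^ n + (+ n * ε * Y ^ (1 ℕ.+ m) + (+ (n C 2) * (ε * ε) * Y ^ m + + 0))
      ≡⟨ eq (Y ^ n) (+ n * ε * Y ^ (1 ℕ.+ m)) (+ (n C 2) * (ε * ε) * Y ^ m) ⟩
    Y ^ n + + n * ε * Y ^ (1 ℕ.+ m) + + (n C 2) * (ε * ε) * Y ^ m ∎
    where
    open ≈-Reasoning
    n = 2 ℕ.+ m
    t = binomialTerm ε Y n
    t₀ = t Fin.zero
    t₁ = t (Fin.suc Fin.zero)
    t₂ = t (Fin.suc (Fin.suc Fin.zero))
    rest : Vector ℤ m
    rest i = t (Fin.suc (Fin.suc (Fin.suc i)))
    eq : ∀ a b c → a + (b + (c + + 0)) ≡ a + b + c
    eq = solve-∀
    second : t₁ ≡ + n * ε * Y ^ (1 ℕ.+ m)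
    second = trans (×-term (n C 1) ε 1 Y (1 ℕ.+ m))
                   (trans (cong (λ c → + c * (ε * + 1) * Y ^ (1 ℕ.+ m)) (nC1≡n n)) (eq₁ (+ n) ε (Y ^ (1 ℕ.+ m))))
      where eq₁ : ∀ c a b → c * (a * + 1) * b ≡ c * a * b
            eq₁ = solve-∀
    third : t₂ ≡ + (n C 2) * (ε * ε) * Y ^ m
    third = trans (×-term (n C 2) ε 2 Y m) (eq₂ (+ (n C 2)) ε (Y ^ m))
      where eq₂ : ∀ c a b → c * (a * (a * + 1)) * b ≡ c * (a * a) * b
            eq₂ = solve-∀
    ε³∣rest : ∀ i → ε * ε * ε ∣ rest i
    ε³∣rest i = subst (ε * ε * ε ∣_) (sym (×≡* (n C (3 ℕ.+ toℕ i)) (ε³⁺ⁱ * Yʲ)))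
      (∣n⇒∣m*n (+ (n C (3 ℕ.+ toℕ i)))
        (∣m⇒∣m*n Yʲ (divides (ε Semiring.^ toℕ i) (eq₃ ε (ε Semiring.^ toℕ i)))))
      where
      ε³⁺ⁱ = ε Semiring.^ (3 ℕ.+ toℕ i)
      Yʲ = Y Semiring.^ (n ℕ.∸ (3 ℕ.+ toℕ i))
      eq₃ : ∀ a b → a * (a * (a * b)) ≡ b * (a * a * a)
      eq₃ = solve-∀
    rest≈0 : sum rest ≈ + 0 [mod ε * ε * ε ]
    rest≈0 = ≈-trans (sum-cong-mod (∣⇒≈0 ∘ ε³∣rest)) (≈-reflexive (sum-replicate-zero m))

  module _ {p : ℕ} (p-prime : Prime p) where

    euclid-ℤ : ∀ {x y} → + p ∣ x * y → + p ∣ x ⊎ + p ∣ y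
    euclid-ℤ {x} {y} p∣xy =
      Sum.map ∣ᵤ⇒∣ ∣ᵤ⇒∣
        (euclidsLemma ℤ.∣ x ∣ ℤ.∣ y ∣ p-prime (subst (p ℕ.∣_) (ℤ.abs-* x y) (∣⇒∣ᵤ p∣xy)))

    ∤-* : ∀ {x y} → ¬ + p ∣ x → ¬ + p ∣ y → ¬ + p ∣ x * y
    ∤-* p∤x p∤y p∣xy = [ p∤x , p∤y ]′ (euclid-ℤ p∣xy)

    ∤-^ : ∀ {x} n → ¬ + p ∣ x → ¬ + p ∣ x ^ n
    ∤-^ zero    p∤x p∣1 =
      ℕ.>⇒≢ (ℕ.nonTrivial⇒n>1 p {{prime⇒nonTrivial p-prime}}) (ℕ.∣1⇒≡1 (∣⇒∣ᵤ p∣1))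
    ∤-^ (suc n) p∤x     = ∤-* p∤x (∤-^ n p∤x)

    ∣-cancel-unit : ∀ {x y} → ¬ + p ∣ x → + p ∣ x * y → + p ∣ y
    ∣-cancel-unit p∤x p∣xy = [ (λ p∣x → contradiction p∣x p∤x) , (λ p∣y → p∣y) ]′ (euclid-ℤ p∣xy)

    *-cancelˡ-mod : ∀ {x y z} → ¬ + p ∣ x → x * y ≈ x * z [mod + p ] → y ≈ z [mod + p ]
    *-cancelˡ-mod {x} {y} {z} p∤x (∣⇒≈ d) = ∣⇒≈ (∣-cancel-unit p∤x (subst (+ p ∣_) (eq x y z) d))
      where eq : ∀ x y z → x * y - x * z ≡ x * (y - z)
            eq = solve-∀

  fermat : ∀ {p} → Prime p → ∀ n → (+ n) ^ p ≈ + n [mod + p ]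
  fermat {suc q} p-prime zero    = ≈-reflexive (ℤ.*-zeroˡ ((+ 0) ^ q))
  fermat {p}     p-prime (suc n) = begin
    (+ 1 + + n) ^ p         ≈⟨ freshmans-dream p-prime (+ 1) (+ n) ⟩
    (+ 1) ^ p + (+ n) ^ p   ≈⟨ +-cong-mod (≈-reflexive (ℤ.^-zeroˡ p)) (fermat p-prime n) ⟩
    + 1 + + n               ∎
    where open ≈-Reasoning

  fermat-unit : ∀ {q} → Prime (suc q) → ∀ {n} → ¬ + suc q ∣ + n → (+ n) ^ q ≈ + 1 [mod + suc q ]
  fermat-unit p-prime {n} p∤n =
    *-cancelˡ-mod p-prime p∤n (≈-trans (fermat p-prime n) (≈-reflexive (sym (ℤ.*-identityʳ (+ n)))))

  -- Roots of polynomials modulo a prime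

  horner : List ℤ → ℤ → ℤ
  horner []       x = + 0
  horner (c ∷ cs) x = c + x * horner cs x

  -- The quotient of the polynomial c + x · cs by x − a; it does not depend on c.
  quotientBy : ℤ → List ℤ → List ℤ
  quotientBy a []       = []
  quotientBy a (c ∷ cs) = horner (c ∷ cs) a ∷ quotientBy a cs

  length-quotientBy : ∀ a cs → length (quotientBy a cs) ≡ length cs
  length-quotientBy a []       = refl
  length-quotientBy a (c ∷ cs) = cong suc (length-quotientBy a cs)

  horner-division : ∀ a c cs x → horner (c ∷ cs) x ≡ (x - a) * horner (quotientBy a cs) x + horner (c ∷ cs) a
  horner-division a c []       x = eq c x a
    where eq : ∀ c x a → c + x * + 0 ≡ (x - a) * + 0 + (c + a * + 0)
          eq = solve-∀
  horner-division a c (d ∷ ds) x =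
    trans (cong (λ h → c + x * h) (horner-division a d ds x)) (eq c x a (horner (d ∷ ds) a) (horner (quotientBy a ds) x))
    where eq : ∀ c x a h q → c + x * ((x - a) * q + h) ≡ (x - a) * (h + x * q) + (c + a * h)
          eq = solve-∀

  module _ {p : ℕ} (p-prime : Prime p) where

    private
      P = + p

    ∣quotient⇒∣coefficients : ∀ a c cs → All (P ∣_) (quotientBy a cs) → P ∣ horner (c ∷ cs) a →
                              All (P ∣_) (c ∷ cs)
    ∣quotient⇒∣coefficients a c []       []          P∣c+a*0 = subst (P ∣_) (eq c a) P∣c+a*0 ∷ []
      where eq : ∀ c a → c + a * + 0 ≡ c
            eq = solve-∀
    ∣quotient⇒∣coefficients a c (d ∷ ds) (P∣h ∷ P∣q) P∣c+a*h =
      subst (P ∣_) (eq c a (horner (d ∷ ds) a)) (∣m∣n⇒∣m-n P∣c+a*h (∣n⇒∣m*n a P∣h))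
        ∷ ∣quotient⇒∣coefficients a d ds P∣q P∣h
      where eq : ∀ c a h → c + a * h - a * h ≡ c
            eq = solve-∀

    roots⇒∣coefficients : ∀ cs xs → length cs ℕ.≤ length xs → AllPairs (λ x y → ¬ P ∣ y - x) xs →
                          All (λ x → P ∣ horner cs x) xs → All (P ∣_) cs
    roots⇒∣coefficients []       xs       _         _                  _                = []
    roots⇒∣coefficients (c ∷ cs) (a ∷ as) (s≤s len) (a≢as ∷ distinct) (root-a ∷ roots) =
      ∣quotient⇒∣coefficients a c cs
        (roots⇒∣coefficients (quotientBy a cs) as
          (subst (ℕ._≤ length as) (sym (length-quotientBy a cs)) len) distinct
          (All.zipWith (λ (P∤b-a , root-b) → root-of-quotient P∤b-a root-b) (a≢as , roots)))
        root-a
      where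
      root-of-quotient : ∀ {b} → ¬ P ∣ b - a → P ∣ horner (c ∷ cs) b → P ∣ horner (quotientBy a cs) b
      root-of-quotient {b} P∤b-a root-b =
        ∣-cancel-unit p-prime P∤b-a (∣m+n∣n⇒∣m (subst (P ∣_) (horner-division a c cs b) root-b) root-a)

  poly : ∀ {n} → Vector ℤ n → ℤ → ℤ
  poly c x = sum λ i → c i * x ^ toℕ i

  horner-tabulate : ∀ {n} (c : Vector ℤ n) x → horner (List.tabulate c) x ≡ poly c x
  horner-tabulate {zero}  c x = refl
  horner-tabulate {suc n} c x = begin
    c Fin.zero + x * horner (List.tabulate (c ∘ Fin.suc)) x
      ≡⟨ cong (λ h → c Fin.zero + x * h) (horner-tabulate (c ∘ Fin.suc) x) ⟩
    c Fin.zero + x * poly (c ∘ Fin.suc) x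
      ≡⟨ cong₂ _+_ (sym (ℤ.*-identityʳ (c Fin.zero))) (*-distribˡ-sum x (λ i → c (Fin.suc i) * x ^ toℕ i)) ⟩
    c Fin.zero * + 1 + sum (λ i → x * (c (Fin.suc i) * x ^ toℕ i))
      ≡⟨ cong (_+_ (c Fin.zero * + 1)) (sum-cong-≗ λ i → eq x (c (Fin.suc i)) (x ^ toℕ i)) ⟩
    poly c x ∎
    where
    open ≡-Reasoning
    eq : ∀ x c y → x * (c * y) ≡ c * (x * y)
    eq = solve-∀

  poly-distrib-- : ∀ {n} (c d : Vector ℤ n) x → poly (λ i → c i - d i) x ≡ poly c x - poly d x
  poly-distrib-- c d x = trans (sum-cong-≗ λ i → eq (c i) (d i) (x ^ toℕ i))
                               (sum-distrib-- (λ i → c i * x ^ toℕ i) (λ i → d i * x ^ toℕ i))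
    where eq : ∀ c d y → (c - d) * y ≡ c * y - d * y
          eq = solve-∀

  poly-cong : ∀ {m n x y} (c : Vector ℤ n) → x ≈ y [mod m ] → poly c x ≈ poly c y [mod m ]
  poly-cong c x≈y = sum-cong-mod λ i → *-congˡ-mod (c i) (^-cong-mod (toℕ i) x≈y)

  poly-roots⇒∣coefficients : ∀ {p n} → Prime p → n ℕ.< p → (c : Vector ℤ n) →
                             (∀ t → + p ∣ poly c (+ suc (toℕ t))) → ∀ s → + p ∣ c s
  poly-roots⇒∣coefficients {p} {n} p-prime n<p c roots =
    All.tabulate⁻ (roots⇒∣coefficients p-prime (List.tabulate c) points
    (ℕ.≤-reflexive (trans (List.length-tabulate c) (sym (List.length-tabulate point))))
    (AllPairs.tabulate⁺ distinct)
    (All.tabulate⁺ λ t → subst (+ p ∣_) (sym (horner-tabulate c (point t))) (roots t)))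
    where
    point : Fin n → ℤ
    point t = + suc (toℕ t)
    points = List.tabulate point
    point<p : ∀ t → suc (toℕ t) ℕ.< p
    point<p t = ℕ.<-≤-trans (s≤s (Fin.toℕ<n t)) n<p
    distinct : ∀ {s t} → s ≢ t → ¬ + p ∣ point t - point s
    distinct {s} {t} s≢t p∣t-s =
      s≢t (Fin.toℕ-injective (ℕ.suc-injective (≈∧<⇒≡ (point<p s) (point<p t) (≈-sym (∣⇒≈ p∣t-s)))))

  -- Euler's totient of a prime power

  applyUpTo-++ : ∀ {A : Set} (f : ℕ → A) m n →
                 applyUpTo f (m ℕ.+ n) ≡ applyUpTo f m ++ applyUpTo (f ∘ (m ℕ.+_)) n
  applyUpTo-++ f zero    n = refl
  applyUpTo-++ f (suc m) n = cong (f 0 ∷_) (applyUpTo-++ (f ∘ suc) m n)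

  module _ {Q : Pred ℕ 0ℓ} (Q? : Decidable Q) where

    length-filter-++ : ∀ xs ys → length (filter Q? (xs ++ ys)) ≡ length (filter Q? xs) ℕ.+ length (filter Q? ys)
    length-filter-++ xs ys = trans (cong length (List.filter-++ Q? xs ys)) (List.length-++ (filter Q? xs))

    -- Each block of q + 1 consecutive numbers ends with a multiple of q + 1.
    length-filter-≤ : ∀ q → (∀ m → suc q ℕ.∣ m → ¬ Q m) →
                      ∀ b → length (filter Q? (applyUpTo suc (b ℕ.* suc q))) ℕ.≤ b ℕ.* q
    length-filter-≤ q reject zero    = z≤n
    length-filter-≤ q reject (suc b) = begin
      count (applyUpTo suc (p ℕ.+ b ℕ.* p))
        ≡⟨ cong (count ∘ applyUpTo suc) (ℕ.+-comm p (b ℕ.* p)) ⟩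
      count (applyUpTo suc (b ℕ.* p ℕ.+ p))
        ≡⟨ cong count (applyUpTo-++ suc (b ℕ.* p) p) ⟩
      count (applyUpTo suc (b ℕ.* p) ++ applyUpTo block p)
        ≡⟨ length-filter-++ (applyUpTo suc (b ℕ.* p)) (applyUpTo block p) ⟩
      count (applyUpTo suc (b ℕ.* p)) ℕ.+ count (applyUpTo block p)
        ≤⟨ ℕ.+-mono-≤ (length-filter-≤ q reject b) count-block ⟩
      b ℕ.* q ℕ.+ q
        ≡⟨ ℕ.+-comm (b ℕ.* q) q ⟩
      suc b ℕ.* q ∎
      where
      open ℕ.≤-Reasoning
      p = suc q
      count : List ℕ → ℕ
      count xs = length (filter Q? xs)
      block : ℕ → ℕ
      block i = suc (b ℕ.* p ℕ.+ i)
      last-rejected : ¬ Q (block q)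
      last-rejected = reject (block q) (ℕ.divides (suc b) (cong suc (ℕ.+-comm (b ℕ.* p) q)))
      count-block : count (applyUpTo block p) ℕ.≤ q
      count-block = begin
        count (applyUpTo block p)                   ≡⟨ cong count (sym (List.applyUpTo-∷ʳ block q)) ⟩
        count (applyUpTo block q ++ block q ∷ [])   ≡⟨ length-filter-++ (applyUpTo block q) (block q ∷ []) ⟩
        count (applyUpTo block q) ℕ.+ count (block q ∷ [])
          ≡⟨ cong (λ xs → count (applyUpTo block q) ℕ.+ length xs) (List.filter-reject Q? last-rejected) ⟩
        count (applyUpTo block q) ℕ.+ 0             ≡⟨ ℕ.+-identityʳ _ ⟩
        count (applyUpTo block q)                   ≤⟨ List.length-filter Q? (applyUpTo block q) ⟩
        length (applyUpTo block q)                  ≡⟨ List.length-applyUpTo block q ⟩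
        q ∎

  totient-prime-power : ∀ q k → 1 ℕ.≤ q → totient (suc q ℕ.^ suc k) ℕ.≤ suc q ℕ.^ k ℕ.* q
  totient-prime-power q k 1≤q = begin
    length (filter coprime-to-K? (List.map suc (upTo K)))
      ≡⟨ cong (length ∘ filter coprime-to-K?)
              (trans (List.map-upTo suc K) (cong (applyUpTo suc) (ℕ.*-comm p (p ℕ.^ k)))) ⟩
    length (filter coprime-to-K? (applyUpTo suc (p ℕ.^ k ℕ.* p)))
      ≤⟨ length-filter-≤ coprime-to-K? q multiple-not-coprime (p ℕ.^ k) ⟩
    p ℕ.^ k ℕ.* q ∎
    where
    open ℕ.≤-Reasoning
    p = suc q
    K = p ℕ.^ suc k
    coprime-to-K? = λ m → coprime? m K
    multiple-not-coprime : ∀ m → p ℕ.∣ m → ¬ Coprime m K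
    multiple-not-coprime m p∣m coprime =
      ℕ.<⇒≢ 1≤q (sym (ℕ.suc-injective (coprime (p∣m , ℕ.divides (p ℕ.^ k) (ℕ.*-comm p (p ℕ.^ k))))))

  -- One term per class of exponents

  -- A polynomial with at most one term in each class of exponents modulo q; a vacant class s
  -- is recorded as the term 0 · xˢ.
  record ClassTerms (p q : ℕ) : Set where
    field
      coefficient exponent : Fin q → ℕ
      exponent-class   : ∀ s → + exponent s ≈ + toℕ s [mod + q ]
      coefficient-unit : ∀ s → + p ∣ + coefficient s → coefficient s ≡ 0
      exponent-vacant  : ∀ s → coefficient s ≡ 0 → exponent s ≡ toℕ s

    value : ℤ → ℤ
    value x = sum λ s → + coefficient s * x ^ exponent s

  entry : ℕ → ℕ → ℕ → ℕ
  entry e c n with e ℕ.≟ n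
  ... | yes _ = c
  ... | no  _ = 0

  entry-zero : ∀ e n → entry e 0 n ≡ 0
  entry-zero e n with e ℕ.≟ n
  ... | yes _ = refl
  ... | no  _ = refl

  module _ {N : ℕ} (q : ℕ) .{{_ : ℕ.NonZero q}} where

    class : Fin N → Fin q
    class i = toℕ i ℕ.mod q

    ≈class : ∀ i → + toℕ i ≈ + toℕ (class i) [mod + q ]
    ≈class i = subst (λ r → + toℕ i ≈ + r [mod + q ]) (sym (Fin.toℕ-fromℕ< _)) (≈% (toℕ i) q)

    toDense : (Fin q → ℕ) → (Fin q → ℕ) → Fin N → ℕ
    toDense exponent coefficient i = entry (exponent (class i)) (coefficient (class i)) (toℕ i)

  module DenseClassTerms {N K : ℕ} (p q : ℕ) .{{_ : ℕ.NonZero q}} (f : Poly K N)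
    (units : ∀ i → NonzeroCoeff f i → ¬ p ℕ.∣ toℕ (f i))
    (separated : ∀ i j → NonzeroCoeff f i → NonzeroCoeff f j →
                 toℕ i ℕ.< toℕ j → ¬ q ℕ.∣ toℕ j ℕ.∸ toℕ i)
    where

    class-injective : ∀ {i j} → class q i ≡ class q j → NonzeroCoeff f i → NonzeroCoeff f j → i ≡ j
    class-injective {i} {j} ci≡cj fi≢0 fj≢0 with ℕ.<-cmp (toℕ i) (toℕ j)
    ... | tri< i<j _ _ = contradiction (≈⇒∣∸ (ℕ.<⇒≤ i<j) i≈j) (separated i j fi≢0 fj≢0 i<j)
      where i≈j = ≈-trans (≈class q i)
                    (≈-trans (≈-reflexive (cong (+_ ∘ toℕ) ci≡cj)) (≈-sym (≈class q j)))
    ... | tri≈ _ i≡j _ = Fin.toℕ-injective i≡j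
    ... | tri> _ _ j<i = contradiction (≈⇒∣∸ (ℕ.<⇒≤ j<i) j≈i) (separated j i fj≢0 fi≢0 j<i)
      where j≈i = ≈-trans (≈class q j)
                    (≈-trans (≈-reflexive (cong (+_ ∘ toℕ) (sym ci≡cj))) (≈-sym (≈class q i)))

    data Term (s : Fin q) : Set where
      vacant   : (∀ i → class q i ≡ s → toℕ (f i) ≡ 0) → Term s
      occupied : ∀ i → class q i ≡ s → NonzeroCoeff f i → Term s

    term : ∀ s → Term s
    term s with Fin.any? (λ i → (class q i Fin.≟ s) ×-dec ¬? (toℕ (f i) ℕ.≟ 0))
    ... | yes (i , ci≡s , fi≢0) = occupied i ci≡s fi≢0
    ... | no  none              =
      vacant λ i ci≡s → decidable-stable (toℕ (f i) ℕ.≟ 0) λ fi≢0 → none (i , ci≡s , fi≢0)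

    module _ {s : Fin q} where

      exponentOf coefficientOf : Term s → ℕ
      exponentOf (vacant _)          = toℕ s
      exponentOf (occupied i _ _)    = toℕ i
      coefficientOf (vacant _)       = 0
      coefficientOf (occupied i _ _) = toℕ (f i)

      exponentOf-class : ∀ t → + exponentOf t ≈ + toℕ s [mod + q ]
      exponentOf-class (vacant _)          = ≈-reflexive refl
      exponentOf-class (occupied i refl _) = ≈class q i

      coefficientOf-unit : ∀ t → + p ∣ + coefficientOf t → coefficientOf t ≡ 0
      coefficientOf-unit (vacant _)          _   = refl
      coefficientOf-unit (occupied i _ fi≢0) p∣c = contradiction (∣⇒∣ᵤ p∣c) (units i fi≢0)

      exponentOf-vacant : ∀ t → coefficientOf t ≡ 0 → exponentOf t ≡ toℕ s
      exponentOf-vacant (vacant _)          _    = refl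
      exponentOf-vacant (occupied i _ fi≢0) fi≡0 = contradiction fi≡0 fi≢0

      coefficientOf-< : 0 ℕ.< K → ∀ t → coefficientOf t ℕ.< K
      coefficientOf-< 0<K (vacant _)       = 0<K
      coefficientOf-< 0<K (occupied i _ _) = Fin.toℕ<n (f i)

      exponentOf-< : ∀ t → coefficientOf t ≢ 0 → exponentOf t ℕ.< N
      exponentOf-< (vacant _)       0≢0 = contradiction refl 0≢0
      exponentOf-< (occupied i _ _) _   = Fin.toℕ<n i

      entry-term : ∀ i → class q i ≡ s → ∀ t → toℕ (f i) ≡ entry (exponentOf t) (coefficientOf t) (toℕ i)
      entry-term i ci≡s (vacant fj≡0) = trans (fj≡0 i ci≡s) (sym (entry-zero (toℕ s) (toℕ i)))
      entry-term i ci≡s (occupied i₀ ci₀≡s fi₀≢0) with toℕ i₀ ℕ.≟ toℕ i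
      ... | yes i₀≡i = cong (toℕ ∘ f) (Fin.toℕ-injective (sym i₀≡i))
      ... | no  i₀≢i = decidable-stable (toℕ (f i) ℕ.≟ 0)
                         λ fi≢0 → i₀≢i (cong toℕ (class-injective (trans ci₀≡s (sym ci≡s)) fi₀≢0 fi≢0))

    terms : ClassTerms p q
    terms = record
      { coefficient      = coefficientOf ∘ term
      ; exponent         = exponentOf ∘ term
      ; exponent-class   = exponentOf-class ∘ term
      ; coefficient-unit = coefficientOf-unit ∘ term
      ; exponent-vacant  = exponentOf-vacant ∘ term
      }

    open ClassTerms terms public using (coefficient; exponent; exponent-vacant; value)

    coefficient-< : 0 ℕ.< K → ∀ s → coefficient s ℕ.< K
    coefficient-< 0<K s = coefficientOf-< 0<K (term s)

    exponent-< : ∀ s → coefficient s ≢ 0 → exponent s ℕ.< N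
    exponent-< s = exponentOf-< (term s)

    toℕ≡toDense : ∀ i → toℕ (f i) ≡ toDense q exponent coefficient i
    toℕ≡toDense i = entry-term i refl (term (class q i))

    private
      monomial : ℕ → Fin N → ℤ
      monomial x i = + toℕ (f i) * (+ x) ^ toℕ i

      monomial-zero : ∀ x i → toℕ (f i) ≡ 0 → monomial x i ≡ + 0
      monomial-zero x i fi≡0 = trans (cong (λ c → + c * (+ x) ^ toℕ i) fi≡0) (ℤ.*-zeroˡ ((+ x) ^ toℕ i))

      inClass : ℕ → Fin q → Fin N → ℤ
      inClass x s i with class q i Fin.≟ s
      ... | yes _ = monomial x i
      ... | no  _ = + 0

      sum-inClass : ∀ x i → sum (λ s → inClass x s i) ≡ monomial x i
      sum-inClass x i = trans (sum-single (λ s → inClass x s i) (class q i) other) own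
        where
        own : inClass x (class q i) i ≡ monomial x i
        own with class q i Fin.≟ class q i
        ... | yes _  = refl
        ... | no  ne = contradiction refl ne
        other : ∀ s → s ≢ class q i → inClass x s i ≡ + 0
        other s s≢ci with class q i Fin.≟ s
        ... | yes ci≡s = contradiction (sym ci≡s) s≢ci
        ... | no  _    = refl

      sum-class : ∀ x {s} (t : Term s) → sum (inClass x s) ≡ + coefficientOf t * (+ x) ^ exponentOf t
      sum-class x {s} (vacant fi≡0) = trans (sum-zero _ zero-entry) (sym (ℤ.*-zeroˡ ((+ x) ^ toℕ s)))
        where
        zero-entry : ∀ i → inClass x s i ≡ + 0
        zero-entry i with class q i Fin.≟ s
        ... | yes ci≡s = monomial-zero x i (fi≡0 i ci≡s)
        ... | no  _    = refl
      sum-class x {s} (occupied i₀ ci₀≡s fi₀≢0) = trans (sum-single _ i₀ other) own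
        where
        own : inClass x s i₀ ≡ monomial x i₀
        own with class q i₀ Fin.≟ s
        ... | yes _  = refl
        ... | no  ne = contradiction ci₀≡s ne
        other : ∀ j → j ≢ i₀ → inClass x s j ≡ + 0
        other j j≢i₀ with class q j Fin.≟ s
        ... | no  _    = refl
        ... | yes cj≡s = monomial-zero x j (decidable-stable (toℕ (f j) ℕ.≟ 0)
                           λ fj≢0 → j≢i₀ (class-injective (trans cj≡s (sym ci₀≡s)) fj≢0 fi₀≢0))

    evalℕ≡value : ∀ x → + evalℕ f x ≡ value (+ x)
    evalℕ≡value x = begin
      + evalℕ f x                                  ≡⟨ ΣFin≡sum N (λ i → toℕ (f i) ℕ.* x ℕ.^ toℕ i) ⟩
      sum (λ i → + (toℕ (f i) ℕ.* x ℕ.^ toℕ i))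
        ≡⟨ sum-cong-≗ (λ i → trans (ℤ.pos-* (toℕ (f i)) (x ℕ.^ toℕ i))
                                   (cong (_*_ (+ toℕ (f i))) (pos-^ x (toℕ i)))) ⟩
      sum (monomial x)                             ≡⟨ sum-cong-≗ (sum-inClass x) ⟨
      sum (λ i → sum (λ s → inClass x s i))        ≡⟨ ∑-comm (λ i s → inClass x s i) ⟩
      sum (λ s → sum (inClass x s))                ≡⟨ sum-cong-≗ (λ s → sum-class x (term s)) ⟩
      value (+ x)                                  ∎
      where open ≡-Reasoning

  -- Lifting along powers of an odd prime

  module OddPrime (n : ℕ) (p-prime : Prime (3 ℕ.+ n)) where

    p q : ℕ
    p = 3 ℕ.+ n
    q = 2 ℕ.+ n

    P : ℤ
    P = + p

    P^-nonZero : ∀ j → ℤ.NonZero (P ^ j)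
    P^-nonZero j = subst ℤ.NonZero (pos-^ p j) (ℕ.m^n≢0 p j)

    P^∣P^ : ∀ {i j} → i ℕ.≤ j → P ^ i ∣ P ^ j
    P^∣P^ {i} {j} i≤j =
      subst (P ^ i ∣_) (trans (sym (ℤ.^-distribˡ-+-* P i (j ℕ.∸ i))) (cong (P ^_) (ℕ.m+[n∸m]≡n i≤j)))
            (∣m⇒∣m*n (P ^ (j ℕ.∸ i)) ∣-refl)

    P∣P^suc : ∀ l → P ∣ P ^ suc l
    P∣P^suc l = divides (P ^ l) (ℤ.*-comm P (P ^ l))

    P∤ : ∀ {m} → 0 ℕ.< m → m ℕ.< p → ¬ P ∣ + m
    P∤ {suc m} _ m<p P∣m = ℕ.>⇒∤ m<p (∣⇒∣ᵤ P∣m)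

    P∤+p : ∀ {m} → ¬ P ∣ + m → ¬ P ∣ + (m ℕ.+ p)
    P∤+p P∤m P∣m+p = P∤m (∣m+n∣n⇒∣m P∣m+p ∣-refl)

    -- (p − 1)pˡ = φ(pˡ⁺¹), the exponent of the unit group of ℤ/pˡ⁺¹ℤ.
    period : ℕ → ℕ
    period l = q ℕ.* p ℕ.^ l

    period-suc : ∀ l → period l ℕ.* p ≡ period (suc l)
    period-suc l = trans (ℕ.*-assoc q (p ℕ.^ l) p) (cong (q ℕ.*_) (ℕ.*-comm (p ℕ.^ l) p))

    ^period-suc : ∀ x l → x ^ period (suc l) ≡ (x ^ period l) ^ p
    ^period-suc x l = trans (cong (x ^_) (sym (period-suc l))) (sym (ℤ.^-*-assoc x (period l) p))

    -- Needs p ∣ C(p, 2), that is, p odd.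
    ^p-expand : ∀ j Y Z → (Y + P ^ suc j * Z) ^ p ≈ Y ^ p + P ^ (2 ℕ.+ j) * (Y ^ q * Z) [mod P ^ (3 ℕ.+ j) ]
    ^p-expand j Y Z = begin
      (Y + ε) ^ p
        ≈⟨ ≈-weaken P³⁺ʲ∣ε³ (binomial₂ (suc n) Y ε) ⟩
      Y ^ p + + p * ε * Y ^ q + + (p C 2) * (ε * ε) * Y ^ suc n
        ≈⟨ +-cong-mod (≈-reflexive (eq₁ P (P ^ j) (Y ^ p) Z (Y ^ q))) (∣⇒≈0 P³⁺ʲ∣C₂-term) ⟩
      Y ^ p + P ^ (2 ℕ.+ j) * (Y ^ q * Z) + + 0
        ≡⟨ ℤ.+-identityʳ _ ⟩
      Y ^ p + P ^ (2 ℕ.+ j) * (Y ^ q * Z) ∎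
      where
      open ≈-Reasoning
      ε = P ^ suc j * Z
      eq₁ : ∀ P Q Y Z Yq → Y + P * (P * Q * Z) * Yq ≡ Y + P * (P * Q) * (Yq * Z)
      eq₁ = solve-∀
      P³⁺ʲ∣ε³ : P ^ (3 ℕ.+ j) ∣ ε * ε * ε
      P³⁺ʲ∣ε³ = divides (P ^ j * P ^ j * Z * Z * Z) (eq₂ P (P ^ j) Z)
        where eq₂ : ∀ P Q Z → P * Q * Z * (P * Q * Z) * (P * Q * Z) ≡ Q * Q * Z * Z * Z * (P * (P * (P * Q)))
              eq₂ = solve-∀
      p∣C₂ = prime∣pCk p-prime (s≤s z≤n) (s≤s (s≤s (s≤s z≤n)))
      c = ℕ._∣_.quotient p∣C₂
      P³⁺ʲ∣C₂-term : P ^ (3 ℕ.+ j) ∣ + (p C 2) * (ε * ε) * Y ^ suc n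
      P³⁺ʲ∣C₂-term = divides (+ c * P ^ j * Z * Z * Y ^ suc n)
        (trans (cong (λ C → + C * (ε * ε) * Y ^ suc n) (ℕ._∣_.equality p∣C₂))
        (trans (cong (λ C → C * (ε * ε) * Y ^ suc n) (ℤ.pos-* c p)) (eq₃ (+ c) P (P ^ j) Z (Y ^ suc n))))
        where eq₃ : ∀ c P Q Z Y → c * P * (P * Q * Z * (P * Q * Z)) * Y ≡ c * Q * Z * Z * Y * (P * (P * (P * Q)))
              eq₃ = solve-∀

    ^p-lift : ∀ j {X} Y Z → X ≈ Y + P ^ suc j * Z [mod P ^ (2 ℕ.+ j) ] →
              X ^ p ≈ Y ^ p + P ^ (2 ℕ.+ j) * (Y ^ q * Z) [mod P ^ (3 ℕ.+ j) ]
    ^p-lift j {X} Y Z X≈ = begin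
      X ^ p                                           ≡⟨ cong (_^ p) X≡ ⟩
      (Y + P ^ suc j * (Z + P * W)) ^ p               ≈⟨ ^p-expand j Y (Z + P * W) ⟩
      Y ^ p + P ^ (2 ℕ.+ j) * (Y ^ q * (Z + P * W))   ≈⟨ ≡+*⇒≈ (Y ^ q * W) (eq₂ P (P ^ j) (Y ^ p) (Y ^ q) Z W) ⟩
      Y ^ p + P ^ (2 ℕ.+ j) * (Y ^ q * Z)             ∎
      where
      open ≈-Reasoning
      W = quotient (≈⇒∣ X≈)
      eq₁ : ∀ P Q Y Z W → Y + P * Q * Z + P * (P * Q) * W ≡ Y + P * Q * (Z + P * W)
      eq₁ = solve-∀
      X≡ : X ≡ Y + P ^ suc j * (Z + P * W)
      X≡ = trans (≈⇒≡+* X≈) (eq₁ P (P ^ j) Y Z W)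
      eq₂ : ∀ P Q Yᵖ Yq Z W →
            Yᵖ + P * (P * Q) * (Yq * (Z + P * W)) ≡ Yᵖ + P * (P * Q) * (Yq * Z) + P * (P * (P * Q)) * (Yq * W)
      eq₂ = solve-∀

    euler : ∀ {t} → ¬ P ∣ + t → ∀ l → (+ t) ^ period l ≈ + 1 [mod P ^ suc l ]
    euler {t} P∤t zero    = ≈-weaken (∣-reflexive (ℤ.*-identityʳ P))
      (subst (λ e → (+ t) ^ e ≈ + 1 [mod P ]) (sym (ℕ.*-identityʳ q)) (fermat-unit p-prime P∤t))
    euler {t} P∤t (suc l) = begin
      (+ t) ^ period (suc l)                        ≡⟨ ^period-suc (+ t) l ⟩
      ((+ t) ^ period l) ^ p
        ≈⟨ ≈-weaken (P^∣P^ (ℕ.n≤1+n (2 ℕ.+ l))) (^p-lift l (+ 1) μ (≈-reflexive (≈⇒≡+* (euler P∤t l)))) ⟩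
      (+ 1) ^ p + P ^ (2 ℕ.+ l) * ((+ 1) ^ q * μ)
        ≈⟨ +-cong-mod (≈-reflexive (ℤ.^-zeroˡ p)) (∣⇒≈0 (∣m⇒∣m*n _ ∣-refl)) ⟩
      + 1                                           ∎
      where
      open ≈-Reasoning
      μ = quotient (≈⇒∣ (euler P∤t l))

    ShiftedPower : ℕ → ℕ → Set
    ShiftedPower t l =
      ∃ λ Z → ¬ P ∣ Z × (+ t + P) ^ period l ≈ (+ t) ^ period l + P ^ suc l * Z [mod P ^ (2 ℕ.+ l) ]

    shiftedPower : ∀ {t} → ¬ P ∣ + t → ∀ l → ShiftedPower t l
    -- The witness is the linear term of the binomial expansion of (t + p)^(p − 1).
    shiftedPower {t} P∤t zero = + q * (+ t) ^ suc n , ∤-* p-prime P∤q (∤-^ p-prime (suc n) P∤t) , subst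
      (λ e → (+ t + P) ^ e ≈ (+ t) ^ e + P ^ 1 * (+ q * (+ t) ^ suc n) [mod P ^ 2 ]) (sym (ℕ.*-identityʳ q)) (begin
      (+ t + P) ^ q                                           ≈⟨ ≈-weaken P²∣P³ (binomial₂ n (+ t) P) ⟩
      (+ t) ^ q + + q * P * (+ t) ^ suc n + + (q C 2) * (P * P) * (+ t) ^ n
        ≈⟨ +-cong-mod (≈-reflexive (eq₁ P (+ q) ((+ t) ^ q) ((+ t) ^ suc n)))
                      (∣⇒≈0 (divides (+ (q C 2) * (+ t) ^ n) (eq₂ P (+ (q C 2)) ((+ t) ^ n)))) ⟩
      (+ t) ^ q + P ^ 1 * (+ q * (+ t) ^ suc n) + + 0         ≡⟨ ℤ.+-identityʳ _ ⟩
      (+ t) ^ q + P ^ 1 * (+ q * (+ t) ^ suc n)               ∎)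
      where
      open ≈-Reasoning
      P∤q : ¬ P ∣ + q
      P∤q = P∤ (s≤s z≤n) (ℕ.n<1+n q)
      P²∣P³ : P ^ 2 ∣ P * P * P
      P²∣P³ = divides P (eq₃ P)
        where eq₃ : ∀ P → P * P * P ≡ P * (P * (P * + 1))
              eq₃ = solve-∀
      eq₁ : ∀ P q T T′ → T + q * P * T′ ≡ T + P * + 1 * (q * T′)
      eq₁ = solve-∀
      eq₂ : ∀ P C T → C * (P * P) * T ≡ C * T * (P * (P * + 1))
      eq₂ = solve-∀
    shiftedPower {t} P∤t (suc l) = step (shiftedPower P∤t l)
      where
      Y = (+ t) ^ period l
      step : ShiftedPower t l → ShiftedPower t (suc l)
      step (Z , P∤Z , X≈) = Y ^ q * Z , ∤-* p-prime (∤-^ p-prime q (∤-^ p-prime (period l) P∤t)) P∤Z , (begin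
        (+ t + P) ^ period (suc l)                             ≡⟨ ^period-suc (+ t + P) l ⟩
        ((+ t + P) ^ period l) ^ p                             ≈⟨ ^p-lift l Y Z X≈ ⟩
        Y ^ p + P ^ (2 ℕ.+ l) * (Y ^ q * Z)
          ≡⟨ cong (_+ P ^ (2 ℕ.+ l) * (Y ^ q * Z)) (^period-suc (+ t) l) ⟨
        (+ t) ^ period (suc l) + P ^ (2 ℕ.+ l) * (Y ^ q * Z)   ∎)
        where open ≈-Reasoning

    μ : ∀ {t} → ¬ P ∣ + t → ℕ → ℤ
    μ P∤t l = quotient (≈⇒∣ (euler P∤t l))

    ^period≡1+P^*μ : ∀ {t} (P∤t : ¬ P ∣ + t) l → (+ t) ^ period l ≡ + 1 + P ^ suc l * μ P∤t l
    ^period≡1+P^*μ P∤t l = ≈⇒≡+* (euler P∤t l)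

    P∤μ-shift : ∀ {t} (P∤t : ¬ P ∣ + t) (P∤t+p : ¬ P ∣ + (t ℕ.+ p)) l → ¬ P ∣ μ P∤t+p l - μ P∤t l
    P∤μ-shift {t} P∤t P∤t+p l = unit-difference (shiftedPower P∤t l)
      where
      A = P ^ suc l
      μ₀ = μ P∤t l
      μ₁ = μ P∤t+p l
      eq₁ : ∀ A a b → A * (a - b) ≡ (+ 1 + A * a) - (+ 1 + A * b)
      eq₁ = solve-∀
      eq₂ : ∀ A Y Z → Y + A * Z - Y ≡ A * Z
      eq₂ = solve-∀
      unit-difference : ShiftedPower t l → ¬ P ∣ μ₁ - μ₀
      unit-difference (Z , P∤Z , X≈) P∣μ₁-μ₀ =
        P∤Z (≈0⇒∣ (≈-trans (≈-sym μ₁-μ₀≈Z) (∣⇒≈0 P∣μ₁-μ₀)))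
        where
        open ≈-Reasoning
        μ₁-μ₀≈Z : μ₁ - μ₀ ≈ Z [mod P ]
        μ₁-μ₀≈Z = *-cancelˡ-≈ A {{P^-nonZero (suc l)}} (begin
          A * (μ₁ - μ₀)                                 ≡⟨ eq₁ A μ₁ μ₀ ⟩
          (+ 1 + A * μ₁) - (+ 1 + A * μ₀)
            ≡⟨ cong₂ _-_ (^period≡1+P^*μ P∤t+p l) (^period≡1+P^*μ P∤t l) ⟨
          (+ t + P) ^ period l - (+ t) ^ period l       ≈⟨ minus-cong-mod X≈ (≈-reflexive refl) ⟩
          (+ t) ^ period l + A * Z - (+ t) ^ period l   ≡⟨ eq₂ A ((+ t) ^ period l) Z ⟩
          A * Z                                         ∎)

    ^-mod-class : ∀ {t e} (s : Fin q) → ¬ P ∣ + t → + e ≈ + toℕ s [mod + q ] →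
                  (+ t) ^ e ≈ (+ t) ^ toℕ s [mod P ]
    ^-mod-class s P∤t = ^-period (fermat-unit p-prime P∤t)

    value-mod-p : ∀ (F : ClassTerms p q) {t} → ¬ P ∣ + t →
                  ClassTerms.value F (+ t) ≈ poly (λ s → + ClassTerms.coefficient F s) (+ t) [mod P ]
    value-mod-p F P∤t = sum-cong-mod λ s → *-congˡ-mod (+ coefficient s) (^-mod-class s P∤t (exponent-class s))
      where open ClassTerms F

    point : Fin q → ℕ
    point t = suc (toℕ t)

    P∤point : ∀ t → ¬ P ∣ + point t
    P∤point t = P∤ (s≤s z≤n) (s≤s (Fin.toℕ<n t))

    module Lifting (F G : ClassTerms p q) (k : ℕ)
      (agree : ∀ t → ClassTerms.value F (+ point t) ≈ ClassTerms.value G (+ point t) [mod P ^ k ]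
                   × ClassTerms.value F (+ (point t ℕ.+ p)) ≈ ClassTerms.value G (+ (point t ℕ.+ p)) [mod P ^ k ])
      where

      open ClassTerms

      a b : Fin q → ℤ
      a s = + coefficient F s
      b s = + coefficient G s

      Agreement : ℕ → Set
      Agreement l = ∀ s → + exponent F s ≈ + exponent G s [mod + period l ] × a s ≈ b s [mod P ^ suc l ]

      agreement-zero : 1 ℕ.≤ k → Agreement 0
      agreement-zero 1≤k s = exponents , coefficients
        where
        exponents : + exponent F s ≈ + exponent G s [mod + period 0 ]
        exponents = subst (λ m → + exponent F s ≈ + exponent G s [mod + m ]) (sym (ℕ.*-identityʳ q))
                          (≈-trans (exponent-class F s) (≈-sym (exponent-class G s)))
        P∣P^k : P ∣ P ^ k
        P∣P^k = ∣-trans (∣-reflexive (sym (ℤ.*-identityʳ P))) (P^∣P^ 1≤k)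
        root : ∀ t → P ∣ poly (λ s → a s - b s) (+ point t)
        root t = ≈0⇒∣ (begin
          poly (λ s → a s - b s) x   ≡⟨ poly-distrib-- a b x ⟩
          poly a x - poly b x        ≈⟨ minus-cong-mod (value-mod-p F (P∤point t)) (value-mod-p G (P∤point t)) ⟨
          value F x - value G x      ≈⟨ ∣⇒≈0 (∣-trans P∣P^k (≈⇒∣ (proj₁ (agree t)))) ⟩
          + 0                        ∎)
          where
          open ≈-Reasoning
          x = + point t
        coefficients : a s ≈ b s [mod P ^ 1 ]
        coefficients = ∣⇒≈ (∣-trans (∣-reflexive (ℤ.*-identityʳ P))
                                    (poly-roots⇒∣coefficients p-prime (ℕ.n<1+n q) (λ s → a s - b s) root s))

      module Step (l : ℕ) (l+2≤k : 2 ℕ.+ l ℕ.≤ k) (agreed : Agreement l) where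

        A = P ^ suc l

        common : ∀ s → CommonBase (period l) (exponent F s) (exponent G s)
        common s = commonBase (proj₁ (agreed s))

        r : Fin q → ℕ
        r s = CommonBase.base (common s)

        δ ε : Fin q → ℤ
        δ s = + CommonBase.d₁ (common s) - + CommonBase.d₂ (common s)
        ε s = quotient (≈⇒∣ (proj₂ (agreed s)))

        -- The next p-adic digits of the coefficient and of the exponent differences.
        E D : ℤ → ℤ
        E = poly ε
        D = poly (λ s → b s * δ s)

        key : ∀ {t} (P∤t : ¬ P ∣ + t) → value F (+ t) ≈ value G (+ t) [mod P ^ k ] →
              P ∣ E (+ t) + μ P∤t l * D (+ t)
        key {t} P∤t agree-t = ≈0⇒∣ (begin
          E x + μₓ * D x   ≈⟨ H≈E+μD ⟨
          H                ≈⟨ H≈0 ⟩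
          + 0              ∎)
          where
          open ≈-Reasoning
          x = + t
          μₓ = μ P∤t l
          h : Fin q → ℤ
          h s = x ^ r s * (ε s + μₓ * b s * δ s)
          H = sum h
          term : ∀ s → a s * x ^ exponent F s - b s * x ^ exponent G s ≈ A * h s [mod A * A ]
          term s = subst₂ (λ eᶠ eᵍ → a s * x ^ eᶠ - b s * x ^ eᵍ ≈ A * h s [mod A * A ]) (sym i≡) (sym j≡)
                     (term-lift A (period l) μₓ (^period≡1+P^*μ P∤t l) (b s) (ε s) (≈⇒≡+* (proj₂ (agreed s)))
                                base d₁ d₂)
            where open CommonBase (common s)
          difference≈AH : value F x - value G x ≈ A * H [mod A * A ]
          difference≈AH = begin
            value F x - value G x
              ≡⟨ sum-distrib-- (λ s → a s * x ^ exponent F s) (λ s → b s * x ^ exponent G s) ⟨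
            sum (λ s → a s * x ^ exponent F s - b s * x ^ exponent G s)
              ≈⟨ sum-cong-mod term ⟩
            sum (λ s → A * h s)
              ≡⟨ *-distribˡ-sum A h ⟨
            A * H ∎
          P*A∣A*A : P * A ∣ A * A
          P*A∣A*A = divides (P ^ l) (eq P (P ^ l))
            where eq : ∀ P Q → P * Q * (P * Q) ≡ Q * (P * (P * Q))
                  eq = solve-∀
          H≈0 : H ≈ + 0 [mod P ]
          H≈0 = *-cancelˡ-≈ A {{P^-nonZero (suc l)}} (begin
            A * H                   ≈⟨ ≈-weaken P*A∣A*A difference≈AH ⟨
            value F x - value G x   ≈⟨ ∣⇒≈0 (∣-trans (P^∣P^ l+2≤k) (≈⇒∣ agree-t)) ⟩
            + 0                     ≡⟨ ℤ.*-zeroʳ A ⟨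
            A * + 0                 ∎)
          x^r≈x^s : ∀ s → x ^ r s ≈ x ^ toℕ s [mod P ]
          x^r≈x^s s = ≈-trans (≈-weaken (P∣P^suc l) (≈-sym x^e≈x^r)) (^-mod-class s P∤t (exponent-class G s))
            where
            open CommonBase (common s)
            x^e≈x^r : x ^ exponent G s ≈ x ^ base [mod A ]
            x^e≈x^r = subst (λ e → x ^ e ≈ x ^ base [mod A ]) (sym j≡)
                            (^-reduce (period l) (euler P∤t l) base d₂)
          eq : ∀ X e μ c → X * (e + μ * c) ≡ e * X + μ * (c * X)
          eq = solve-∀
          H≈E+μD : H ≈ E x + μₓ * D x [mod P ]
          H≈E+μD = begin
            H
              ≈⟨ sum-cong-mod (λ s → *-cong-mod (x^r≈x^s s) (≈-reflexive {x = ε s + μₓ * b s * δ s} refl)) ⟩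
            sum (λ s → x ^ toℕ s * (ε s + μₓ * b s * δ s))
              ≡⟨ sum-cong-≗ (λ s → trans (cong (λ y → x ^ toℕ s * (ε s + y)) (ℤ.*-assoc μₓ (b s) (δ s)))
                                         (eq (x ^ toℕ s) (ε s) μₓ (b s * δ s))) ⟩
            sum (λ s → ε s * x ^ toℕ s + μₓ * (b s * δ s * x ^ toℕ s))
              ≡⟨ ∑-distrib-+ (λ s → ε s * x ^ toℕ s) (λ s → μₓ * (b s * δ s * x ^ toℕ s)) ⟩
            E x + sum (λ s → μₓ * (b s * δ s * x ^ toℕ s))
              ≡⟨ cong (_+_ (E x)) (*-distribˡ-sum μₓ (λ s → b s * δ s * x ^ toℕ s)) ⟨
            E x + μₓ * D x ∎

        -- At t and t + p, E and D agree modulo p while μ differs by a unit.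
        vanish : ∀ t → P ∣ D (+ point t) × P ∣ E (+ point t)
        vanish t = P∣D₀ , P∣E₀
          where
          x₀ = point t
          P∤x₀ = P∤point t
          P∤x₁ = P∤+p P∤x₀
          μ₀ = μ P∤x₀ l
          μ₁ = μ P∤x₁ l
          E₀ = E (+ x₀)
          D₀ = D (+ x₀)
          E₁ = E (+ (x₀ ℕ.+ p))
          D₁ = D (+ (x₀ ℕ.+ p))
          key₀ : P ∣ E₀ + μ₀ * D₀
          key₀ = key P∤x₀ (proj₁ (agree t))
          key₁ : P ∣ E₁ + μ₁ * D₁
          key₁ = key P∤x₁ (proj₂ (agree t))
          x₁≈x₀ : + (x₀ ℕ.+ p) ≈ + x₀ [mod P ]
          x₁≈x₀ = ≡+*⇒≈ (+ 1) (cong (_+_ (+ x₀)) (sym (ℤ.*-identityʳ P)))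
          eq : ∀ E μ₀ μ₁ D → (μ₁ - μ₀) * D ≡ (E + μ₁ * D) - (E + μ₀ * D)
          eq = solve-∀
          [μ₁-μ₀]*D₀≈0 : (μ₁ - μ₀) * D₀ ≈ + 0 [mod P ]
          [μ₁-μ₀]*D₀≈0 = begin
            (μ₁ - μ₀) * D₀                    ≡⟨ eq E₀ μ₀ μ₁ D₀ ⟩
            (E₀ + μ₁ * D₀) - (E₀ + μ₀ * D₀)
              ≈⟨ minus-cong-mod (+-cong-mod (poly-cong ε x₁≈x₀)
                                            (*-congˡ-mod μ₁ (poly-cong (λ s → b s * δ s) x₁≈x₀)))
                                (≈-reflexive refl) ⟨
            (E₁ + μ₁ * D₁) - (E₀ + μ₀ * D₀)   ≈⟨ minus-cong-mod (∣⇒≈0 key₁) (∣⇒≈0 key₀) ⟩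
            + 0                               ∎
            where open ≈-Reasoning
          P∣D₀ : P ∣ D₀
          P∣D₀ = ∣-cancel-unit p-prime (P∤μ-shift P∤x₀ P∤x₁ l) (≈0⇒∣ [μ₁-μ₀]*D₀≈0)
          eq₂ : ∀ E μ D → E + μ * D - μ * D ≡ E
          eq₂ = solve-∀
          P∣E₀ : P ∣ E₀
          P∣E₀ = subst (P ∣_) (eq₂ E₀ μ₀ D₀) (∣m∣n⇒∣m-n key₀ (∣n⇒∣m*n μ₀ P∣D₀))

        P∣ε : ∀ s → P ∣ ε s
        P∣ε = poly-roots⇒∣coefficients p-prime (ℕ.n<1+n q) ε (proj₂ ∘ vanish)

        P∣bδ : ∀ s → P ∣ b s * δ s
        P∣bδ = poly-roots⇒∣coefficients p-prime (ℕ.n<1+n q) (λ s → b s * δ s) (proj₁ ∘ vanish)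

        next : Agreement (suc l)
        next s = exponents , coefficients (P∣ε s)
          where
          coefficients : P ∣ ε s → a s ≈ b s [mod P ^ (2 ℕ.+ l) ]
          coefficients (divides e ε≡eP) = ≡+*⇒≈ e (trans (≈⇒≡+* (proj₂ (agreed s)))
                                            (trans (cong (λ z → b s + A * z) ε≡eP) (eq (b s) A e P)))
            where eq : ∀ b A e P → b + A * (e * P) ≡ b + P * A * e
                  eq = solve-∀
          both-vacant : P ∣ b s → + exponent F s ≈ + exponent G s [mod + period (suc l) ]
          both-vacant P∣b =
            ≈-reflexive (cong +_ (trans (exponent-vacant F s cᶠ≡0) (sym (exponent-vacant G s cᵍ≡0))))
            where
            cᵍ≡0 = coefficient-unit G s P∣b
            P∣a : P ∣ a s
            P∣a = ≈0⇒∣ (≈-trans (≈-weaken (P∣P^suc l) (proj₂ (agreed s))) (∣⇒≈0 P∣b))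
            cᶠ≡0 = coefficient-unit F s P∣a
          exponents : + exponent F s ≈ + exponent G s [mod + period (suc l) ]
          exponents = [ both-vacant
                      , (λ P∣δ → subst (λ m → + exponent F s ≈ + exponent G s [mod + m ]) (period-suc l)
                                       (commonBase-≈ (common s) P∣δ)) ]′ (euclid-ℤ p-prime (P∣bδ s))

      agreement : ∀ l → suc l ℕ.≤ k → Agreement l
      agreement zero    1≤k   = agreement-zero 1≤k
      agreement (suc l) l+2≤k = Step.next l l+2≤k (agreement l (ℕ.<⇒≤ l+2≤k))

    module Uniqueness (k : ℕ) (f g : Poly (p ℕ.^ suc k) (totient (p ℕ.^ suc k)))
      (reduces-f : ReducesWell p f) (reduces-g : ReducesWell p g)
      (agree : ∀ a → InSampleSet p a → SameValueAt f g a) where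

      module Fᵈ = DenseClassTerms p q f (proj₁ reduces-f) (proj₂ reduces-f)
      module Gᵈ = DenseClassTerms p q g (proj₁ reduces-g) (proj₂ reduces-g)

      agree-at : ∀ a → InSampleSet p a → Fᵈ.value (+ a) ≈ Gᵈ.value (+ a) [mod P ^ suc k ]
      agree-at a a∈S = ∣⇒≈ (subst₂ _∣_ (pos-^ p (suc k))
                                  (cong₂ _-_ (Fᵈ.evalℕ≡value a) (Gᵈ.evalℕ≡value a))
                                  (∣ᵤ⇒∣ (agree a a∈S)))

      samples : ∀ t → InSampleSet p (point t) × InSampleSet p (point t ℕ.+ p)
      samples t =
        (s≤s z≤n , ℕ.≤-trans (ℕ.≤-trans point≤q (ℕ.m≤m+n q p)) q+p≤2p-1 , ℕ.<⇒≢ (s≤s point≤q)) ,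
        (s≤s z≤n , ℕ.≤-trans (ℕ.+-monoˡ-≤ p point≤q) q+p≤2p-1 , ℕ.>⇒≢ (ℕ.m<n+m p (s≤s z≤n)))
        where
        point≤q = Fin.toℕ<n t
        q+p≤2p-1 : q ℕ.+ p ℕ.≤ 2 ℕ.* p ℕ.∸ 1
        q+p≤2p-1 = ℕ.≤-reflexive (cong (λ m → 2 ℕ.+ (n ℕ.+ m)) (sym (ℕ.+-identityʳ p)))

      agree-at-samples : ∀ t → Fᵈ.value (+ point t) ≈ Gᵈ.value (+ point t) [mod P ^ suc k ]
                             × Fᵈ.value (+ (point t ℕ.+ p)) ≈ Gᵈ.value (+ (point t ℕ.+ p)) [mod P ^ suc k ]
      agree-at-samples t = agree-at _ (proj₁ (samples t)) , agree-at _ (proj₂ (samples t))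

      open Lifting Fᵈ.terms Gᵈ.terms (suc k) agree-at-samples

      coefficients-equal : ∀ s → Fᵈ.coefficient s ≡ Gᵈ.coefficient s
      coefficients-equal s = ≈∧<⇒≡ (Fᵈ.coefficient-< pᵏ⁺¹>0 s) (Gᵈ.coefficient-< pᵏ⁺¹>0 s)
        (subst (λ m → + Fᵈ.coefficient s ≈ + Gᵈ.coefficient s [mod m ]) (sym (pos-^ p (suc k)))
               (proj₂ (agreement k ℕ.≤-refl s)))
        where pᵏ⁺¹>0 = ℕ.>-nonZero⁻¹ (p ℕ.^ suc k) {{ℕ.m^n≢0 p (suc k)}}

      exponents-equal : ∀ s → Fᵈ.exponent s ≡ Gᵈ.exponent s
      exponents-equal s = by-cases (Fᵈ.coefficient s ℕ.≟ 0)
        where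
        N≤period : totient (p ℕ.^ suc k) ℕ.≤ period k
        N≤period = ℕ.≤-trans (totient-prime-power q k (s≤s z≤n)) (ℕ.≤-reflexive (ℕ.*-comm (p ℕ.^ k) q))
        below-period : ∀ {e} → e ℕ.< totient (p ℕ.^ suc k) → e ℕ.< period k
        below-period e<N = ℕ.<-≤-trans e<N N≤period
        by-cases : Dec (Fᵈ.coefficient s ≡ 0) → Fᵈ.exponent s ≡ Gᵈ.exponent s
        by-cases (yes cᶠ≡0) =
          trans (Fᵈ.exponent-vacant s cᶠ≡0) (sym (Gᵈ.exponent-vacant s (trans (sym (coefficients-equal s)) cᶠ≡0)))
        by-cases (no cᶠ≢0) =
          ≈∧<⇒≡ (below-period (Fᵈ.exponent-< s cᶠ≢0))
                (below-period (Gᵈ.exponent-< s λ cᵍ≡0 → cᶠ≢0 (trans (coefficients-equal s) cᵍ≡0)))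
                (proj₁ (agreement k ℕ.≤-refl s))

      f≡g : ∀ i → f i ≡ g i
      f≡g i = Fin.toℕ-injective (begin
        toℕ (f i)                                ≡⟨ Fᵈ.toℕ≡toDense i ⟩
        toDense q Fᵈ.exponent Fᵈ.coefficient i
          ≡⟨ cong₂ (λ e c → entry e c (toℕ i)) (exponents-equal (class q i)) (coefficients-equal (class q i)) ⟩
        toDense q Gᵈ.exponent Gᵈ.coefficient i   ≡⟨ Gᵈ.toℕ≡toDense i ⟨
        toℕ (g i)                                ∎)
        where open ≡-Reasoning

open import Defs
open import Data.Nat using (ℕ; zero; suc; _≤_; _^_)
open import Data.Nat.Primality using (Prime; prime⇒nonTrivial)
open import Relation.Nullary using (¬_; contradiction)
open import Relation.Binary.PropositionalEquality using (_≡_; refl)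

corollary3p10 : (p k t : ℕ) → Prime p → ¬ (p ≡ 2) → 2 ≤ k →
    (f g : Poly (p ^ k) (totient (p ^ k))) →
    IsTNomial t f → ReducesWell p f →
    IsTNomial t g → ReducesWell p g →
    (∀ a → InSampleSet p a → SameValueAt f g a) →
    ∀ i → f i ≡ g i
corollary3p10 zero                _       _ p-prime = contradiction (prime⇒nonTrivial p-prime) λ ()
corollary3p10 (suc zero)          _       _ p-prime = contradiction (prime⇒nonTrivial p-prime) λ ()
corollary3p10 (suc (suc zero))    _       _ _ p≢2   = contradiction refl p≢2
corollary3p10 (suc (suc (suc n))) (suc k) _ p-prime _ _ f g _ reduces-f _ reduces-g agree =
  Proof.OddPrime.Uniqueness.f≡g n p-prime k f g reduces-f reduces-g agree
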